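{- For any $\alpha\ge3/2$, any one-pass streaming algorithm that, with probability at least $2/3$, produces an estimate $\tilde L_1\in(1\pm1/16)\|f\|_1$ for general turnstile streams $f$ over $[n]$ with the $L_1$ $\alpha$-property requires $\Omega(\log n)$ bits of space.
   Context: A data stream over $[n]$ is a sequence of updates $(i_t,\Delta_t)\in[n]\times\{ -M,\dots,M\}$, $t=1,\dots,m$, defining the frequency vector $f\in\mathbb{R}^n$ (initially $0$, each update sets $f_{i_t}\leftarrow f_{i_t}+\Delta_t$); it is assumed $\log(mM)=O(\log n)$. In the general turnstile model the $\Delta_t$ may be arbitrary integers in $\{ -M,\dots,M\}$. The insertion vector $I$ is the frequency vector of the substream of updates with $\Delta_t\ge0$, the deletion vector $D$ is the entrywise absolute value of the frequency vector of the substream of updates with $\Delta_t<0$, and the stream has the $L_1$ $\alpha$-property if $\|I+D\|_1\le\alpha\|f\|_1$. -}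

module Defs where

open import Data.Nat as ℕ using (ℕ; zero; suc; _^_)
open import Data.Integer as ℤ using (ℤ; +_; ∣_∣)
open import Data.Rational as ℚ using (ℚ; _/_; 0ℚ; 1ℚ)
open import Data.Rational.Properties using (_≤?_)
open import Data.Fin using (Fin)
open import Data.List using (List; []; _∷_; foldr; map; length; allFin)
open import Data.List.Relation.Unary.All using (All)
open import Data.Product using (_×_; _,_; proj₁; proj₂)
open import Data.Bool using (if_then_else_)
open import Relation.Nullary using (does)
open import Relation.Binary.PropositionalEquality using (_≡_)
open import Data.Fin using (_≟_)

Update : ℕ → Set
Update n = Fin n × ℤ

Stream : ℕ → Set
Stream n = List (Update n)

sumℕ : ∀ {n} → (Fin n → ℕ) → ℕ
sumℕ {n} g = foldr ℕ._+_ 0 (map g (allFin n))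

freq : ∀ {n} → Stream n → Fin n → ℤ
freq [] i = + 0
freq ((j , Δ) ∷ σ) i = if does (i ≟ j) then Δ ℤ.+ freq σ i else freq σ i

insVec : ∀ {n} → Stream n → Fin n → ℕ
insVec [] i = 0
insVec ((j , + k) ∷ σ) i = if does (i ≟ j) then k ℕ.+ insVec σ i else insVec σ i
insVec ((j , ℤ.-[1+ k ]) ∷ σ) i = insVec σ i

delVec : ∀ {n} → Stream n → Fin n → ℕ
delVec [] i = 0
delVec ((j , + k) ∷ σ) i = delVec σ i
delVec ((j , ℤ.-[1+ k ]) ∷ σ) i = if does (i ≟ j) then suc k ℕ.+ delVec σ i else delVec σ i

L1 : ∀ {n} → Stream n → ℕ
L1 σ = sumℕ (λ i → ∣ freq σ i ∣)

L1ID : ∀ {n} → Stream n → ℕ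
L1ID σ = sumℕ (λ i → insVec σ i ℕ.+ delVec σ i)

toℚ : ℕ → ℚ
toℚ k = + k / 1

AlphaProperty : ∀ {n} → ℚ → Stream n → Set
AlphaProperty α σ = toℚ (L1ID σ) ℚ.≤ α ℚ.* toℚ (L1 σ)

ValidStream : ∀ {n} → ℕ → ℕ → Stream n → Set
ValidStream m M σ = length σ ℕ.≤ m × All (λ u → ∣ proj₂ u ∣ ℕ.≤ M) σ

-- A randomized one-pass streaming algorithm over [n] using s bits of space:
-- its memory state is one of 2^s states; at initialisation, at every
-- update and at output time it draws a fresh uniform random value from a
-- finite set Fin (suc r) (r arbitrary).
record StreamAlg (n s : ℕ) : Set where
  field
    r    : ℕ
    init : Fin (suc r) → Fin (2 ^ s)
    step : Fin (suc r) → Fin (2 ^ s) → Update n → Fin (2 ^ s)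
    out  : Fin (suc r) → Fin (2 ^ s) → ℚ

GoodEstimate : ℕ → ℚ → Set
GoodEstimate L e = ((+ 15 / 16) ℚ.* toℚ L ℚ.≤ e) × (e ℚ.≤ (+ 17 / 16) ℚ.* toℚ L)

goodEstimate? : ℕ → ℚ → ℚ
goodEstimate? L e =
  if does ((+ 15 / 16) ℚ.* toℚ L ≤? e)
  then (if does (e ≤? (+ 17 / 16) ℚ.* toℚ L) then 1ℚ else 0ℚ)
  else 0ℚ

module _ {n s : ℕ} (A : StreamAlg n s) where
  open StreamAlg A

  avg : (Fin (suc r) → ℚ) → ℚ
  avg g = foldr ℚ._+_ 0ℚ (map g (allFin (suc r))) ℚ.* (+ 1 / suc r)

  successFrom : ℕ → Fin (2 ^ s) → Stream n → ℚ
  successFrom L q [] = avg (λ c → goodEstimate? L (out c q))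
  successFrom L q (u ∷ σ) = avg (λ c → successFrom L (step c q u) σ)

  successProb : Stream n → ℚ
  successProb σ = avg (λ c → successFrom (L1 σ) (init c) σ)

SolvesL1 : ∀ {n s} → ℚ → ℕ → ℕ → StreamAlg n s → Set
SolvesL1 {n} α m M A =
  (σ : Stream n) → ValidStream m M σ → AlphaProperty α σ →
  (+ 2 / 3) ℚ.≤ successProb A σ

{-# OPTIONS --safe #-}
-- Alice holds x ∈ {0,1}ⁿ and streams +5 or −5 to coordinate i according to xᵢ; Bob holds y and
-- streams −1 or +1.  Then ‖f‖₁ = 4n + 2·d(x,y) and ‖I+D‖₁ = 6n, so the α-property holds for
-- α ≥ 3/2, and a (1 ± 1/16)-estimate tells d(x,y) = 0 apart from d(x,y) > 4n/15.
-- Alice's message is the algorithm's state distribution after her half of the stream, rounded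
-- down to multiples of 1/(3·2ˢ+1); it takes at most (3·2ˢ+2)^(2ˢ) values.  Two inputs with the
-- same message give state distributions at total variation distance at most 2ˢ/(3·2ˢ+1) < 1/3,
-- so if Bob holds one of them the algorithm cannot succeed with probability 2/3 on both streams:
-- inputs with the same message are at Hamming distance at most n/3.  A Hamming ball of radius
-- n/3 has at most 2^(n/3)·(3/2)ⁿ points, hence 2ⁿ ≤ (3·2ˢ+2)^(2ˢ)·2^(n/3)·(3/2)ⁿ, which forces
-- n ≤ 15·(3+s)·2ˢ, i.e. ⌊log₂ n⌋ ≤ 8s once n ≥ 46.
module Submission where

open import Defs
open import Algebra.Bundles using (Monoid; CommutativeRing)
import Algebra.Properties.CommutativeSemigroup as CommutativeSemigroupProperties
import Algebra.Properties.Monoid.Sum as MonoidSum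
import Algebra.Properties.Semiring.Sum as SemiringSum
open import Data.Bool.Base using (Bool; true; false; if_then_else_; _xor_)
import Data.Bool.Properties as BoolP
open import Data.Empty using (⊥; ⊥-elim)
open import Data.Fin
  using (Fin; zero; suc; _≟_; _↑ˡ_; _↑ʳ_; splitAt; combine; fromℕ<; toℕ; funToFin; finToFun)
import Data.Fin.Properties as FinP
open import Data.Integer as ℤ using (ℤ; +_; -[1+_]; ∣_∣)
import Data.Integer.Properties as ℤP
open import Data.List as List using ([]; _∷_; _++_; allFin)
import Data.List.Properties as ListP
import Data.List.Relation.Unary.All.Properties as AllP
import Data.Nat as ℕ
open import Data.Nat using (ℕ; zero; suc; _+_; _*_; _^_; _≤_; _<_)
import Data.Nat.Coprimality as Coprime
import Data.Nat.DivMod as DivMod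
open import Data.Nat.Logarithm using (⌊log₂_⌋; ⌊log₂⌋-mono-≤; ⌊log₂[2^n]⌋≡n)
import Data.Nat.Properties as ℕP
import Data.Nat.Solver as ℕSolver
open import Data.Nat.Tactic.RingSolver using (solve-∀)
open import Data.Product using (Σ; ∃; _×_; _,_; proj₁; proj₂)
open import Data.Rational as ℚ using (ℚ; mkℚ; _/_; 0ℚ; 1ℚ)
import Data.Rational.Properties as ℚP
import Data.Rational.Solver as ℚSolver
open import Data.Sum using (_⊎_; inj₁; inj₂)
open import Data.Vec as Vec using (Vec; []; _∷_; countᵇ)
import Data.Vec.Functional as Vector
import Data.Vec.Properties as VecP
open import Function using (_∘_; id)
open import Function.Bundles using (Inverse; Injection)
open import Function.Properties.Inverse using (↔⇒↣)
open import Level using (0ℓ)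
open import Relation.Binary.PropositionalEquality
open import Relation.Nullary using (Dec; does; yes; no)
open import Relation.Nullary.Decidable using (dec-true; dec-false)

module +-CS = CommutativeSemigroupProperties ℕP.+-commutativeSemigroup
module *-CS = CommutativeSemigroupProperties ℕP.*-commutativeSemigroup

toℚ≡mkℚ : ∀ a → toℚ a ≡ mkℚ (+ a) 0 (Coprime.sym (Coprime.1-coprimeTo a))
toℚ≡mkℚ a = ℚP.normalize-coprime (Coprime.sym (Coprime.1-coprimeTo a))

toℚ-homo-+ : ∀ a b → toℚ (a + b) ≡ toℚ a ℚ.+ toℚ b
toℚ-homo-+ a b rewrite toℚ≡mkℚ a | toℚ≡mkℚ b =
  cong (_/ 1) (sym (cong₂ ℤ._+_ (ℤP.*-identityʳ (+ a)) (ℤP.*-identityʳ (+ b))))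

toℚ-homo-* : ∀ a b → toℚ (a * b) ≡ toℚ a ℚ.* toℚ b
toℚ-homo-* a b rewrite toℚ≡mkℚ a | toℚ≡mkℚ b = cong (_/ 1) (ℤP.pos-* a b)

toℚ-mono-≤ : ∀ {a b} → a ≤ b → toℚ a ℚ.≤ toℚ b
toℚ-mono-≤ {a} {b} a≤b rewrite toℚ≡mkℚ a | toℚ≡mkℚ b =
  ℚ.*≤* (subst₂ ℤ._≤_ (sym (ℤP.*-identityʳ (+ a))) (sym (ℤP.*-identityʳ (+ b))) (ℤ.+≤+ a≤b))

toℚ-cancel-≤ : ∀ {a b} → toℚ a ℚ.≤ toℚ b → a ≤ b
toℚ-cancel-≤ {a} {b} le rewrite toℚ≡mkℚ a | toℚ≡mkℚ b with le
... | ℚ.*≤* p = ℤP.drop‿+≤+ (subst₂ ℤ._≤_ (ℤP.*-identityʳ (+ a)) (ℤP.*-identityʳ (+ b)) p)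

toℚ-mono-< : ∀ {a b} → a < b → toℚ a ℚ.< toℚ b
toℚ-mono-< {a} {b} a<b rewrite toℚ≡mkℚ a | toℚ≡mkℚ b =
  ℚ.*<* (subst₂ ℤ._<_ (sym (ℤP.*-identityʳ (+ a))) (sym (ℤP.*-identityʳ (+ b))) (ℤ.+<+ a<b))

toℚ-nonNeg : ∀ a → ℚ.NonNegative (toℚ a)
toℚ-nonNeg a = ℚ.nonNegative (toℚ-mono-≤ {0} {a} ℕ.z≤n)

toℚ-suc-*-inverse : ∀ r → toℚ (suc r) ℚ.* (+ 1 / suc r) ≡ 1ℚ
toℚ-suc-*-inverse r
  rewrite toℚ≡mkℚ (suc r) | ℚP.normalize-coprime {1} {r} (Coprime.1-coprimeTo (suc r)) =
  ℚP.*-inverseʳ (mkℚ (+ suc r) 0 (Coprime.sym (Coprime.1-coprimeTo (suc r))))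

foldr-tabulate : ∀ {A : Set} (_∙_ : A → A → A) e {k} (g : Fin k → A) →
                 List.foldr _∙_ e (List.tabulate g) ≡ Vector.foldr _∙_ e g
foldr-tabulate _∙_ e {zero}  g = refl
foldr-tabulate _∙_ e {suc k} g = cong (g zero ∙_) (foldr-tabulate _∙_ e (g ∘ suc))

foldr-map-allFin : ∀ {A : Set} (_∙_ : A → A → A) e {k} (g : Fin k → A) →
                   List.foldr _∙_ e (List.map g (allFin k)) ≡ Vector.foldr _∙_ e g
foldr-map-allFin _∙_ e g =
  trans (cong (List.foldr _∙_ e) (ListP.map-tabulate id g)) (foldr-tabulate _∙_ e g)

does-≟-sym : ∀ {k} (i j : Fin k) → does (i ≟ j) ≡ does (j ≟ i)
does-≟-sym i j with i ≟ j
... | yes i≡j = sym (dec-true (j ≟ i) (sym i≡j))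
... | no  i≢j = sym (dec-false (j ≟ i) (i≢j ∘ sym))

module _ (M : Monoid 0ℓ 0ℓ) where
  open Monoid M using (Carrier; _≈_; ε; ∙-congˡ; identityˡ; identityʳ) renaming (trans to ≈-trans)
  open MonoidSum M using (sum; sum-replicate-zero)

  sum-indicator : ∀ {k} (i : Fin k) (v : Fin k → Carrier) →
                  sum (λ j → if does (i ≟ j) then v j else ε) ≈ v i
  sum-indicator {suc k} zero    v = ≈-trans (∙-congˡ (sum-replicate-zero k)) (identityʳ (v zero))
  sum-indicator {suc k} (suc i) v = ≈-trans (identityˡ _) (sum-indicator i (v ∘ suc))

module ℚΣ = SemiringSum (CommutativeRing.semiring ℚP.+-*-commutativeRing)
module ℕΣ = SemiringSum ℕP.+-*-semiring
module ℤΣ = MonoidSum ℤP.+-0-monoid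

sumℕ≡sum : ∀ {k} (g : Fin k → ℕ) → sumℕ g ≡ ℕΣ.sum g
sumℕ≡sum = foldr-map-allFin ℕ._+_ 0

sum-mono-≤ : ∀ {k} {f g : Fin k → ℚ} → (∀ i → f i ℚ.≤ g i) → ℚΣ.sum f ℚ.≤ ℚΣ.sum g
sum-mono-≤ {zero}  f≤g = ℚP.≤-refl
sum-mono-≤ {suc k} f≤g = ℚP.+-mono-≤ (f≤g zero) (sum-mono-≤ (f≤g ∘ suc))

sum-const : ∀ k c → ℚΣ.sum {k} (λ _ → c) ≡ toℚ k ℚ.* c
sum-const zero    c = sym (ℚP.*-zeroˡ c)
sum-const (suc k) c = begin
  c ℚ.+ ℚΣ.sum {k} (λ _ → c)  ≡⟨ cong₂ ℚ._+_ (sym (ℚP.*-identityˡ c)) (sum-const k c) ⟩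
  1ℚ ℚ.* c ℚ.+ toℚ k ℚ.* c    ≡⟨ sym (ℚP.*-distribʳ-+ c 1ℚ (toℚ k)) ⟩
  (1ℚ ℚ.+ toℚ k) ℚ.* c        ≡⟨ cong (ℚ._* c) (sym (toℚ-homo-+ 1 k)) ⟩
  toℚ (suc k) ℚ.* c           ∎
  where open ≡-Reasoning

average : ∀ r → (Fin (suc r) → ℚ) → ℚ
average r g = List.foldr ℚ._+_ 0ℚ (List.map g (allFin (suc r))) ℚ.* (+ 1 / suc r)

average≡sum* : ∀ r g → average r g ≡ ℚΣ.sum g ℚ.* (+ 1 / suc r)
average≡sum* r g = cong (ℚ._* (+ 1 / suc r)) (foldr-map-allFin ℚ._+_ 0ℚ g)

record IsExpectation {A : Set} (𝔼 : (A → ℚ) → ℚ) : Set where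
  field
    cong-≗ : ∀ {g h} → (∀ x → g x ≡ h x) → 𝔼 g ≡ 𝔼 h
    +-homo : ∀ g h → 𝔼 (λ x → g x ℚ.+ h x) ≡ 𝔼 g ℚ.+ 𝔼 h
    *-homo : ∀ c g → 𝔼 (λ x → c ℚ.* g x) ≡ c ℚ.* 𝔼 g
    mono   : ∀ {g h} → (∀ x → g x ℚ.≤ h x) → 𝔼 g ℚ.≤ 𝔼 h
    const  : ∀ c → 𝔼 (λ _ → c) ≡ c

average-isExpectation : ∀ r → IsExpectation (average r)
average-isExpectation r = record
  { cong-≗ = λ {g} {h} g≗h → trans (average≡sum* r g)
               (trans (cong (ℚ._* w) (ℚΣ.sum-cong-≗ g≗h)) (sym (average≡sum* r h)))
  ; +-homo = λ g h → begin
      average r (λ x → g x ℚ.+ h x)           ≡⟨ average≡sum* r (λ x → g x ℚ.+ h x) ⟩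
      ℚΣ.sum (λ x → g x ℚ.+ h x) ℚ.* w         ≡⟨ cong (ℚ._* w) (ℚΣ.∑-distrib-+ g h) ⟩
      (ℚΣ.sum g ℚ.+ ℚΣ.sum h) ℚ.* w            ≡⟨ ℚP.*-distribʳ-+ w (ℚΣ.sum g) (ℚΣ.sum h) ⟩
      ℚΣ.sum g ℚ.* w ℚ.+ ℚΣ.sum h ℚ.* w        ≡⟨ cong₂ ℚ._+_ (average≡sum* r g) (average≡sum* r h) ⟨
      average r g ℚ.+ average r h               ∎
  ; *-homo = λ c g → begin
      average r (λ x → c ℚ.* g x)    ≡⟨ average≡sum* r (λ x → c ℚ.* g x) ⟩
      ℚΣ.sum (λ x → c ℚ.* g x) ℚ.* w  ≡⟨ cong (ℚ._* w) (sym (ℚΣ.*-distribˡ-sum c g)) ⟩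
      c ℚ.* ℚΣ.sum g ℚ.* w            ≡⟨ ℚP.*-assoc c (ℚΣ.sum g) w ⟩
      c ℚ.* (ℚΣ.sum g ℚ.* w)          ≡⟨ cong (c ℚ.*_) (sym (average≡sum* r g)) ⟩
      c ℚ.* average r g               ∎
  ; mono   = λ {g} {h} g≤h → subst₂ ℚ._≤_ (sym (average≡sum* r g)) (sym (average≡sum* r h))
               (ℚP.*-monoʳ-≤-nonNeg w {{ℚP.normalize-nonNeg 1 (suc r)}} (sum-mono-≤ g≤h))
  ; const  = λ c → begin
      average r (λ _ → c)            ≡⟨ average≡sum* r (λ _ → c) ⟩
      ℚΣ.sum {suc r} (λ _ → c) ℚ.* w  ≡⟨ cong (ℚ._* w) (sum-const (suc r) c) ⟩
      toℚ (suc r) ℚ.* c ℚ.* w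
        ≡⟨ solve 3 (λ a c w → a :* c :* w := c :* (a :* w)) refl (toℚ (suc r)) c w ⟩
      c ℚ.* (toℚ (suc r) ℚ.* w)       ≡⟨ cong (c ℚ.*_) (toℚ-suc-*-inverse r) ⟩
      c ℚ.* 1ℚ                        ≡⟨ ℚP.*-identityʳ c ⟩
      c                               ∎
  }
  where
  open ≡-Reasoning
  open ℚSolver.+-*-Solver using (solve; _:*_; _:=_)
  w : ℚ
  w = + 1 / suc r

dirac-isExpectation : ∀ {A : Set} (x : A) → IsExpectation (λ g → g x)
dirac-isExpectation x = record
  { cong-≗ = λ g≗h → g≗h x
  ; +-homo = λ _ _ → refl
  ; *-homo = λ _ _ → refl
  ; mono   = λ g≤h → g≤h x
  ; const  = λ _ → refl
  }

bind-isExpectation : ∀ {A B : Set} {𝔼 : (A → ℚ) → ℚ} {𝔽 : A → (B → ℚ) → ℚ} →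
  IsExpectation 𝔼 → (∀ a → IsExpectation (𝔽 a)) → IsExpectation (λ g → 𝔼 (λ a → 𝔽 a g))
bind-isExpectation {𝔼 = 𝔼} {𝔽} 𝔼-isE 𝔽-isE = record
  { cong-≗ = λ g≗h → E.cong-≗ (λ a → F.cong-≗ a g≗h)
  ; +-homo = λ g h → trans (E.cong-≗ (λ a → F.+-homo a g h)) (E.+-homo (λ a → 𝔽 a g) (λ a → 𝔽 a h))
  ; *-homo = λ c g → trans (E.cong-≗ (λ a → F.*-homo a c g)) (E.*-homo c (λ a → 𝔽 a g))
  ; mono   = λ g≤h → E.mono (λ a → F.mono a g≤h)
  ; const  = λ c → trans (E.cong-≗ (λ a → F.const a c)) (E.const c)
  }
  where
  module E = IsExpectation 𝔼-isE
  module F a = IsExpectation (𝔽-isE a)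

module _ {A : Set} {𝔼 : (A → ℚ) → ℚ} (isE : IsExpectation 𝔼) where
  open IsExpectation isE

  expectation-sum : ∀ {m} (F : Fin m → A → ℚ) →
                    𝔼 (λ x → ℚΣ.sum (λ j → F j x)) ≡ ℚΣ.sum (λ j → 𝔼 (F j))
  expectation-sum {zero}  F = const 0ℚ
  expectation-sum {suc m} F = trans (+-homo (F zero) (λ x → ℚΣ.sum (λ j → F (suc j) x)))
                                    (cong (𝔼 (F zero) ℚ.+_) (expectation-sum (F ∘ suc)))

  expectation-≤ : ∀ {g c} → (∀ x → g x ℚ.≤ c) → 𝔼 g ℚ.≤ c
  expectation-≤ {c = c} g≤c = subst (_ ℚ.≤_) (const c) (mono g≤c)

  ≤-expectation : ∀ {g c} → (∀ x → c ℚ.≤ g x) → c ℚ.≤ 𝔼 g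
  ≤-expectation {c = c} c≤g = subst (ℚ._≤ _) (const c) (mono c≤g)

  expectation-exclusive : ∀ {g h} → (∀ x → g x ℚ.+ h x ℚ.≤ 1ℚ) → 𝔼 g ℚ.+ 𝔼 h ℚ.≤ 1ℚ
  expectation-exclusive {g} {h} g+h≤1 = subst (ℚ._≤ 1ℚ) (+-homo g h) (expectation-≤ g+h≤1)

IndicatorOf : Set → ℚ → Set
IndicatorOf P v = v ≡ 0ℚ ⊎ (v ≡ 1ℚ × P)

0≤indicatorOf : ∀ {P v} → IndicatorOf P v → 0ℚ ℚ.≤ v
0≤indicatorOf (inj₁ refl)       = ℚP.≤-refl
0≤indicatorOf (inj₂ (refl , _)) = ℚP.≤ᵇ⇒≤ _

indicatorOf-≤1 : ∀ {P v} → IndicatorOf P v → v ℚ.≤ 1ℚ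
indicatorOf-≤1 (inj₁ refl)       = ℚP.≤ᵇ⇒≤ _
indicatorOf-≤1 (inj₂ (refl , _)) = ℚP.≤-refl

indicatorOf-exclusive : ∀ {P Q u v} → (P → Q → ⊥) → IndicatorOf P u → IndicatorOf Q v →
                        u ℚ.+ v ℚ.≤ 1ℚ
indicatorOf-exclusive _      (inj₁ refl)       (inj₁ refl)       = ℚP.≤ᵇ⇒≤ _
indicatorOf-exclusive _      (inj₁ refl)       (inj₂ (refl , _)) = ℚP.≤-refl
indicatorOf-exclusive _      (inj₂ (refl , _)) (inj₁ refl)       = ℚP.≤-refl
indicatorOf-exclusive ¬P∧Q   (inj₂ (_ , p))    (inj₂ (_ , q))    = ⊥-elim (¬P∧Q p q)

if-indicatorOf : ∀ {P : Set} (p? : Dec P) → IndicatorOf P (if does p? then 1ℚ else 0ℚ)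
if-indicatorOf (yes p) = inj₂ (refl , p)
if-indicatorOf (no _)  = inj₁ refl

if-if-indicatorOf : ∀ {P Q : Set} (p? : Dec P) (q? : Dec Q) →
  IndicatorOf (P × Q) (if does p? then (if does q? then 1ℚ else 0ℚ) else 0ℚ)
if-if-indicatorOf (yes p) (yes q) = inj₂ (refl , p , q)
if-if-indicatorOf (yes _) (no _)  = inj₁ refl
if-if-indicatorOf (no _)  _       = inj₁ refl

indicator : ∀ {k} → Fin k → Fin k → ℚ
indicator q x = if does (x ≟ q) then 1ℚ else 0ℚ

sum-*-indicator : ∀ {k} (g : Fin k → ℚ) x → ℚΣ.sum (λ q → g q ℚ.* indicator q x) ≡ g x
sum-*-indicator g x = trans (ℚΣ.sum-cong-≗ (λ q → *-if (does (x ≟ q)) (g q))) (sum-indicator ℚP.+-0-monoid x g)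
  where
  *-if : ∀ b p → p ℚ.* (if b then 1ℚ else 0ℚ) ≡ (if b then p else 0ℚ)
  *-if true  p = ℚP.*-identityʳ p
  *-if false p = ℚP.*-zeroʳ p

module _ {k} {𝔼 : (Fin k → ℚ) → ℚ} (isE : IsExpectation 𝔼) where
  open IsExpectation isE

  expectation-as-sum : ∀ g → 𝔼 g ≡ ℚΣ.sum (λ q → g q ℚ.* 𝔼 (indicator q))
  expectation-as-sum g = begin
    𝔼 g                                              ≡⟨ cong-≗ (λ x → sum-*-indicator g x) ⟨
    𝔼 (λ x → ℚΣ.sum (λ q → g q ℚ.* indicator q x))  ≡⟨ expectation-sum isE (λ q x → g q ℚ.* indicator q x) ⟩
    ℚΣ.sum (λ q → 𝔼 (λ x → g q ℚ.* indicator q x))  ≡⟨ ℚΣ.sum-cong-≗ (λ q → *-homo (g q) (indicator q)) ⟩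
    ℚΣ.sum (λ q → g q ℚ.* 𝔼 (indicator q))          ∎
    where open ≡-Reasoning

  expectation-indicator≤1 : ∀ q → 𝔼 (indicator q) ℚ.≤ 1ℚ
  expectation-indicator≤1 q = expectation-≤ isE (λ x → indicatorOf-≤1 (if-indicatorOf (x ≟ q)))

  0≤expectation-indicator : ∀ q → 0ℚ ℚ.≤ 𝔼 (indicator q)
  0≤expectation-indicator q = ≤-expectation isE (λ x → 0≤indicatorOf (if-indicatorOf (x ≟ q)))

expectation-≤-shift : ∀ {k} {𝔼₁ 𝔼₂ : (Fin k → ℚ) → ℚ} → IsExpectation 𝔼₁ → IsExpectation 𝔼₂ →
  ∀ w .{{_ : ℚ.NonNegative w}} → (∀ q → 𝔼₁ (indicator q) ℚ.≤ 𝔼₂ (indicator q) ℚ.+ w) →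
  ∀ {g} → (∀ x → 0ℚ ℚ.≤ g x) → (∀ x → g x ℚ.≤ 1ℚ) →
  𝔼₁ g ℚ.≤ 𝔼₂ g ℚ.+ toℚ k ℚ.* w
expectation-≤-shift {k} {𝔼₁} {𝔼₂} isE₁ isE₂ w close {g} 0≤g g≤1 = begin
  𝔼₁ g                                           ≡⟨ expectation-as-sum isE₁ g ⟩
  ℚΣ.sum (λ q → g q ℚ.* P₁ q)                    ≤⟨ sum-mono-≤ term ⟩
  ℚΣ.sum (λ q → g q ℚ.* P₂ q ℚ.+ w)              ≡⟨ ℚΣ.∑-distrib-+ (λ q → g q ℚ.* P₂ q) (λ _ → w) ⟩
  ℚΣ.sum (λ q → g q ℚ.* P₂ q) ℚ.+ ℚΣ.sum {k} (λ _ → w)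
                                 ≡⟨ cong₂ ℚ._+_ (sym (expectation-as-sum isE₂ g)) (sum-const k w) ⟩
  𝔼₂ g ℚ.+ toℚ k ℚ.* w                           ∎
  where
  open ℚP.≤-Reasoning
  P₁ P₂ : Fin k → ℚ
  P₁ q = 𝔼₁ (indicator q)
  P₂ q = 𝔼₂ (indicator q)
  term : ∀ q → g q ℚ.* P₁ q ℚ.≤ g q ℚ.* P₂ q ℚ.+ w
  term q = begin
    g q ℚ.* P₁ q                   ≤⟨ ℚP.*-monoˡ-≤-nonNeg (g q) {{ℚ.nonNegative (0≤g q)}} (close q) ⟩
    g q ℚ.* (P₂ q ℚ.+ w)           ≡⟨ ℚP.*-distribˡ-+ (g q) (P₂ q) w ⟩
    g q ℚ.* P₂ q ℚ.+ g q ℚ.* w     ≤⟨ ℚP.+-monoʳ-≤ (g q ℚ.* P₂ q) (ℚP.*-monoʳ-≤-nonNeg w (g≤1 q)) ⟩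
    g q ℚ.* P₂ q ℚ.+ 1ℚ ℚ.* w      ≡⟨ cong (g q ℚ.* P₂ q ℚ.+_) (ℚP.*-identityˡ w) ⟩
    g q ℚ.* P₂ q ℚ.+ w             ∎

goodEstimate?-indicatorOf : ∀ L e → IndicatorOf (GoodEstimate L e) (goodEstimate? L e)
goodEstimate?-indicatorOf L e =
  if-if-indicatorOf ((+ 15 / 16) ℚ.* toℚ L ℚP.≤? e) (e ℚP.≤? (+ 17 / 16) ℚ.* toℚ L)

good-estimates-exclusive : ∀ {L L′ e} → 17 * L < 15 * L′ → GoodEstimate L e → GoodEstimate L′ e → ⊥
good-estimates-exclusive {L} {L′} {e} 17L<15L′ (_ , e≤hi) (lo′≤e , _) =
  ℕP.<⇒≱ 17L<15L′ (toℚ-cancel-≤ (ℚP.*-cancelʳ-≤-pos w (begin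
    toℚ (15 * L′) ℚ.* w      ≡⟨ sixteenths 15 L′ ⟨
    toℚ 15 ℚ.* w ℚ.* toℚ L′  ≡⟨⟩
    + 15 / 16 ℚ.* toℚ L′     ≤⟨ lo′≤e ⟩
    e                        ≤⟨ e≤hi ⟩
    + 17 / 16 ℚ.* toℚ L      ≡⟨⟩
    toℚ 17 ℚ.* w ℚ.* toℚ L   ≡⟨ sixteenths 17 L ⟩
    toℚ (17 * L) ℚ.* w       ∎)))
  where
  open ℚP.≤-Reasoning
  open ℚSolver.+-*-Solver using (solve; _:*_; _:=_)
  w : ℚ
  w = + 1 / 16
  sixteenths : ∀ a L → toℚ a ℚ.* w ℚ.* toℚ L ≡ toℚ (a * L) ℚ.* w
  sixteenths a L = trans (solve 3 (λ a w l → a :* w :* l := a :* l :* w) refl (toℚ a) w (toℚ L))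
                         (cong (ℚ._* w) (sym (toℚ-homo-* a L)))

0≤goodEstimate? : ∀ L e → 0ℚ ℚ.≤ goodEstimate? L e
0≤goodEstimate? L e = 0≤indicatorOf (goodEstimate?-indicatorOf L e)

goodEstimate?≤1 : ∀ L e → goodEstimate? L e ℚ.≤ 1ℚ
goodEstimate?≤1 L e = indicatorOf-≤1 (goodEstimate?-indicatorOf L e)

goodEstimate?-exclusive : ∀ {L L′} e → 17 * L < 15 * L′ →
                          goodEstimate? L e ℚ.+ goodEstimate? L′ e ℚ.≤ 1ℚ
goodEstimate?-exclusive {L} {L′} e 17L<15L′ =
  indicatorOf-exclusive (good-estimates-exclusive {L} {L′} 17L<15L′)
    (goodEstimate?-indicatorOf L e) (goodEstimate?-indicatorOf L′ e)

-- Lemmas about level case on the decision inside helpers rather than by `with`, since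
-- abstracting over it makes Agda normalise toℚ (suc j).
level : ℚ → ℚ → ℕ → ℕ
level w P zero    = zero
level w P (suc j) = if does (toℚ (suc j) ℚ.* w ℚP.≤? P) then suc j else level w P j

level-≤ : ∀ w P j → level w P j ≤ j
level-≤ w P zero    = ℕ.z≤n
level-≤ w P (suc j) = step (does (toℚ (suc j) ℚ.* w ℚP.≤? P))
  where
  step : ∀ b → (if b then suc j else level w P j) ≤ suc j
  step true  = ℕP.≤-refl
  step false = ℕP.m≤n⇒m≤1+n (level-≤ w P j)

level-sound : ∀ w P j → 0ℚ ℚ.≤ P → toℚ (level w P j) ℚ.* w ℚ.≤ P
level-sound w P zero    0≤P = subst (ℚ._≤ P) (sym (ℚP.*-zeroˡ w)) 0≤P
level-sound w P (suc j) 0≤P = step (toℚ (suc j) ℚ.* w ℚP.≤? P)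
  where
  step : (d : Dec (toℚ (suc j) ℚ.* w ℚ.≤ P)) →
         toℚ (if does d then suc j else level w P j) ℚ.* w ℚ.≤ P
  step (yes le) = le
  step (no _)   = level-sound w P j 0≤P

level-maximal : ∀ w P j → level w P j < j → P ℚ.< toℚ (suc (level w P j)) ℚ.* w
level-maximal w P (suc j) = step (toℚ (suc j) ℚ.* w ℚP.≤? P)
  where
  step : (d : Dec (toℚ (suc j) ℚ.* w ℚ.≤ P)) → let k = if does d then suc j else level w P j in
         k < suc j → P ℚ.< toℚ (suc k) ℚ.* w
  step (yes _) lt = ⊥-elim (ℕP.<-irrefl refl lt)
  step (no ≰)  _  with ℕP.m≤n⇒m<n∨m≡n (level-≤ w P j)
  ... | inj₁ lt = level-maximal w P j lt
  ... | inj₂ eq = subst (λ k → P ℚ.< toℚ (suc k) ℚ.* w) (sym eq) (ℚP.≰⇒> ≰)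

level-close : ∀ w .{{_ : ℚ.NonNegative w}} P P′ j → 0ℚ ℚ.≤ P → P′ ℚ.≤ toℚ j ℚ.* w →
              level w P j ≡ level w P′ j → P′ ℚ.≤ P ℚ.+ w
level-close w P P′ j 0≤P P′≤jw same with ℕP.m≤n⇒m<n∨m≡n (level-≤ w P j)
... | inj₁ lt = ℚP.<⇒≤ (begin-strict
  P′                               <⟨ subst (λ k → P′ ℚ.< toℚ (suc k) ℚ.* w) (sym same)
                                        (level-maximal w P′ j (subst (_< j) same lt)) ⟩
  toℚ (suc k) ℚ.* w                ≡⟨ cong (ℚ._* w) (toℚ-homo-+ 1 k) ⟩
  (1ℚ ℚ.+ toℚ k) ℚ.* w             ≡⟨ ℚP.*-distribʳ-+ w 1ℚ (toℚ k) ⟩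
  1ℚ ℚ.* w ℚ.+ toℚ k ℚ.* w         ≡⟨ ℚP.+-comm (1ℚ ℚ.* w) (toℚ k ℚ.* w) ⟩
  toℚ k ℚ.* w ℚ.+ 1ℚ ℚ.* w         ≡⟨ cong (toℚ k ℚ.* w ℚ.+_) (ℚP.*-identityˡ w) ⟩
  toℚ k ℚ.* w ℚ.+ w                ≤⟨ ℚP.+-monoˡ-≤ w (level-sound w P j 0≤P) ⟩
  P ℚ.+ w                          ∎)
  where
  open ℚP.≤-Reasoning
  k : ℕ
  k = level w P j
... | inj₂ k≡j = begin
  P′                      ≤⟨ P′≤jw ⟩
  toℚ j ℚ.* w             ≡⟨ cong (λ k → toℚ k ℚ.* w) (sym k≡j) ⟩
  toℚ (level w P j) ℚ.* w ≤⟨ level-sound w P j 0≤P ⟩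
  P                       ≡⟨ ℚP.+-identityʳ P ⟨
  P ℚ.+ 0ℚ                ≤⟨ ℚP.+-monoʳ-≤ P (ℚP.nonNegative⁻¹ w) ⟩
  P ℚ.+ w                 ∎
  where open ℚP.≤-Reasoning

module Run {n s} (A : StreamAlg n s) where
  open StreamAlg A

  State : Set
  State = Fin (2 ^ s)

  runFrom : State → Stream n → (State → ℚ) → ℚ
  runFrom q []      g = g q
  runFrom q (u ∷ σ) g = average r (λ c → runFrom (step c q u) σ g)

  run : Stream n → (State → ℚ) → ℚ
  run σ g = average r (λ c → runFrom (init c) σ g)

  runFrom-isExpectation : ∀ q σ → IsExpectation (runFrom q σ)
  runFrom-isExpectation q []      = dirac-isExpectation q
  runFrom-isExpectation q (u ∷ σ) =
    bind-isExpectation (average-isExpectation r) (λ c → runFrom-isExpectation (step c q u) σ)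

  run-isExpectation : ∀ σ → IsExpectation (run σ)
  run-isExpectation σ =
    bind-isExpectation (average-isExpectation r) (λ c → runFrom-isExpectation (init c) σ)

  runFrom-++ : ∀ q σ τ g → runFrom q (σ ++ τ) g ≡ runFrom q σ (λ q′ → runFrom q′ τ g)
  runFrom-++ q []      τ g = refl
  runFrom-++ q (u ∷ σ) τ g =
    IsExpectation.cong-≗ (average-isExpectation r) (λ c → runFrom-++ (step c q u) σ τ g)

  run-++ : ∀ σ τ g → run (σ ++ τ) g ≡ run σ (λ q → runFrom q τ g)
  run-++ σ τ g = IsExpectation.cong-≗ (average-isExpectation r) (λ c → runFrom-++ (init c) σ τ g)

  outputSuccess : ℕ → State → ℚ
  outputSuccess L q = average r (λ c → goodEstimate? L (out c q))

  successFrom≡runFrom : ∀ L q σ → successFrom A L q σ ≡ runFrom q σ (outputSuccess L)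
  successFrom≡runFrom L q []      = refl
  successFrom≡runFrom L q (u ∷ σ) =
    IsExpectation.cong-≗ (average-isExpectation r) (λ c → successFrom≡runFrom L (step c q u) σ)

  successProb≡run : ∀ σ → successProb A σ ≡ run σ (outputSuccess (L1 σ))
  successProb≡run σ =
    IsExpectation.cong-≗ (average-isExpectation r) (λ c → successFrom≡runFrom (L1 σ) (init c) σ)

  statePr : Stream n → State → ℚ
  statePr σ q = run σ (indicator q)

  module _ (τ : Stream n) (L : ℕ) where

    successAfter : State → ℚ
    successAfter q = runFrom q τ (outputSuccess L)

    0≤successAfter : ∀ q → 0ℚ ℚ.≤ successAfter q
    0≤successAfter q = ≤-expectation (runFrom-isExpectation q τ)
      (λ q′ → ≤-expectation (average-isExpectation r) (λ c → 0≤goodEstimate? L (out c q′)))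

    successAfter≤1 : ∀ q → successAfter q ℚ.≤ 1ℚ
    successAfter≤1 q = expectation-≤ (runFrom-isExpectation q τ)
      (λ q′ → expectation-≤ (average-isExpectation r) (λ c → goodEstimate?≤1 L (out c q′)))

  successAfter-exclusive : ∀ τ {L L′} q → 17 * L < 15 * L′ →
                           successAfter τ L q ℚ.+ successAfter τ L′ q ℚ.≤ 1ℚ
  successAfter-exclusive τ {L} {L′} q 17L<15L′ =
    expectation-exclusive (runFrom-isExpectation q τ) {outputSuccess L} {outputSuccess L′} (λ q′ →
      expectation-exclusive (average-isExpectation r)
        {λ c → goodEstimate? L (out c q′)} {λ c → goodEstimate? L′ (out c q′)}
        (λ c → goodEstimate?-exclusive {L} {L′} (out c q′) 17L<15L′))

  successProb-++ : ∀ σ τ → successProb A (σ ++ τ) ≡ run σ (successAfter τ (L1 (σ ++ τ)))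
  successProb-++ σ τ = trans (successProb≡run (σ ++ τ)) (run-++ σ τ (outputSuccess (L1 (σ ++ τ))))

  nearby-states⇒¬both-succeed : ∀ σ₁ σ₂ τ w .{{_ : ℚ.NonNegative w}} →
    toℚ (3 * 2 ^ s) ℚ.* w ℚ.< 1ℚ →
    (∀ q → statePr σ₁ q ℚ.≤ statePr σ₂ q ℚ.+ w) →
    17 * L1 (σ₁ ++ τ) < 15 * L1 (σ₂ ++ τ) →
    (+ 2 / 3) ℚ.≤ successProb A (σ₁ ++ τ) → (+ 2 / 3) ℚ.≤ successProb A (σ₂ ++ τ) → ⊥
  nearby-states⇒¬both-succeed σ₁ σ₂ τ w 3·2^s·w<1 nearby 17L₁<15L₂ succeeds₁ succeeds₂ =
    ℚP.<-irrefl refl (begin-strict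
      two-thirds ℚ.+ two-thirds
        ≤⟨ ℚP.+-mono-≤ (subst (two-thirds ℚ.≤_) (successProb-++ σ₁ τ) succeeds₁)
                       (subst (two-thirds ℚ.≤_) (successProb-++ σ₂ τ) succeeds₂) ⟩
      run σ₁ g₁ ℚ.+ run σ₂ g₂
        ≤⟨ ℚP.+-monoˡ-≤ (run σ₂ g₂) (expectation-≤-shift (run-isExpectation σ₁) (run-isExpectation σ₂)
                                       w nearby (0≤successAfter τ L₁) (successAfter≤1 τ L₁)) ⟩
      run σ₂ g₁ ℚ.+ X ℚ.+ run σ₂ g₂
        ≡⟨ solve 3 (λ a x b → a :+ x :+ b := a :+ b :+ x) refl (run σ₂ g₁) X (run σ₂ g₂) ⟩
      run σ₂ g₁ ℚ.+ run σ₂ g₂ ℚ.+ X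
        ≤⟨ ℚP.+-monoˡ-≤ X (expectation-exclusive (run-isExpectation σ₂) {g₁} {g₂}
                             (λ q → successAfter-exclusive τ {L₁} {L₂} q 17L₁<15L₂)) ⟩
      1ℚ ℚ.+ X
        <⟨ 1+X<4/3 ⟩
      two-thirds ℚ.+ two-thirds ∎)
    where
    open ℚP.≤-Reasoning
    open ℚSolver.+-*-Solver using (solve; _:+_; _:*_; _:=_)
    two-thirds X : ℚ
    two-thirds = + 2 / 3
    X = toℚ (2 ^ s) ℚ.* w
    L₁ L₂ : ℕ
    L₁ = L1 (σ₁ ++ τ)
    L₂ = L1 (σ₂ ++ τ)
    g₁ g₂ : State → ℚ
    g₁ = successAfter τ L₁
    g₂ = successAfter τ L₂
    1+X<4/3 : 1ℚ ℚ.+ X ℚ.< two-thirds ℚ.+ two-thirds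
    1+X<4/3 = ℚP.+-monoʳ-< 1ℚ (begin-strict
      X                                      ≡⟨ ℚP.*-identityˡ X ⟨
      1ℚ ℚ.* X                               ≡⟨⟩
      + 1 / 3 ℚ.* toℚ 3 ℚ.* X                ≡⟨ solve 4 (λ a b c w → a :* b :* (c :* w) := a :* (b :* c :* w))
                                                          refl (+ 1 / 3) (toℚ 3) (toℚ (2 ^ s)) w ⟩
      + 1 / 3 ℚ.* (toℚ 3 ℚ.* toℚ (2 ^ s) ℚ.* w)
                                             ≡⟨ cong (λ t → + 1 / 3 ℚ.* (t ℚ.* w)) (toℚ-homo-* 3 (2 ^ s)) ⟨
      + 1 / 3 ℚ.* (toℚ (3 * 2 ^ s) ℚ.* w)    <⟨ ℚP.*-monoʳ-<-pos (+ 1 / 3) 3·2^s·w<1 ⟩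
      + 1 / 3 ℚ.* 1ℚ                         ≡⟨⟩
      + 1 / 3                                ∎)

module Fingerprint {n s} (A : StreamAlg n s) (N : ℕ) where
  open Run A

  resolution : ℚ
  resolution = + 1 / suc N

  stateLevel : Stream n → State → Fin (suc (suc N))
  stateLevel σ q = fromℕ< (ℕ.s≤s (level-≤ resolution (statePr σ q) (suc N)))

  stateLevel-close : ∀ σ₁ σ₂ → (∀ q → stateLevel σ₁ q ≡ stateLevel σ₂ q) →
                     ∀ q → statePr σ₂ q ℚ.≤ statePr σ₁ q ℚ.+ resolution
  stateLevel-close σ₁ σ₂ same q =
    level-close resolution {{ℚP.normalize-nonNeg 1 (suc N)}} (statePr σ₁ q) (statePr σ₂ q) (suc N)
      (0≤expectation-indicator (run-isExpectation σ₁) q)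
      (subst (statePr σ₂ q ℚ.≤_) (sym (toℚ-suc-*-inverse N))
             (expectation-indicator≤1 (run-isExpectation σ₂) q))
      (trans (sym (FinP.toℕ-fromℕ< _)) (trans (cong toℕ (same q)) (FinP.toℕ-fromℕ< _)))

freq-++ : ∀ {n} (σ τ : Stream n) i → freq (σ ++ τ) i ≡ freq σ i ℤ.+ freq τ i
freq-++ []            τ i = sym (ℤP.+-identityˡ (freq τ i))
freq-++ ((j , Δ) ∷ σ) τ i = trans (cong (λ f → if does (i ≟ j) then Δ ℤ.+ f else f) (freq-++ σ τ i))
                                  (if-+-assoc (does (i ≟ j)))
  where
  if-+-assoc : ∀ b → (if b then Δ ℤ.+ (freq σ i ℤ.+ freq τ i) else freq σ i ℤ.+ freq τ i)
                     ≡ (if b then Δ ℤ.+ freq σ i else freq σ i) ℤ.+ freq τ i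
  if-+-assoc true  = sym (ℤP.+-assoc Δ (freq σ i) (freq τ i))
  if-+-assoc false = refl

freq-tabulate : ∀ {n m} (ρ : Fin m → Fin n) (v : Fin m → ℤ) i →
  freq (List.tabulate (λ j → (ρ j , v j))) i ≡ ℤΣ.sum (λ j → if does (i ≟ ρ j) then v j else + 0)
freq-tabulate {m = zero}  ρ v i = refl
freq-tabulate {m = suc m} ρ v i =
  trans (cong (λ f → if does (i ≟ ρ zero) then v zero ℤ.+ f else f) (freq-tabulate (ρ ∘ suc) (v ∘ suc) i))
        (if-+ (does (i ≟ ρ zero)))
  where
  if-+ : ∀ b {f} → (if b then v zero ℤ.+ f else f) ≡ (if b then v zero else + 0) ℤ.+ f
  if-+ true  = refl
  if-+ false = sym (ℤP.+-identityˡ _)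

vectorStream : ∀ {n} → (Fin n → ℤ) → Stream n
vectorStream v = List.tabulate (λ j → (j , v j))

freq-vectorStream : ∀ {n} (v : Fin n → ℤ) i → freq (vectorStream v) i ≡ v i
freq-vectorStream v i = trans (freq-tabulate (λ j → j) v i) (sum-indicator ℤP.+-0-monoid i v)

updateMass : ∀ {n} → Stream n → ℕ
updateMass []            = 0
updateMass ((_ , Δ) ∷ σ) = ∣ Δ ∣ + updateMass σ

updateMass-++ : ∀ {n} (σ τ : Stream n) → updateMass (σ ++ τ) ≡ updateMass σ + updateMass τ
updateMass-++ []            τ = refl
updateMass-++ ((_ , Δ) ∷ σ) τ =
  trans (cong (∣ Δ ∣ ℕ.+_) (updateMass-++ σ τ)) (sym (ℕP.+-assoc ∣ Δ ∣ (updateMass σ) (updateMass τ)))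

updateMass-tabulate : ∀ {n m} (ρ : Fin m → Fin n) (v : Fin m → ℤ) {c} → (∀ j → ∣ v j ∣ ≡ c) →
                      updateMass (List.tabulate (λ j → (ρ j , v j))) ≡ m * c
updateMass-tabulate {m = zero}  ρ v ∣v∣≡c = refl
updateMass-tabulate {m = suc m} ρ v ∣v∣≡c =
  cong₂ _+_ (∣v∣≡c zero) (updateMass-tabulate (ρ ∘ suc) (v ∘ suc) (∣v∣≡c ∘ suc))

insVec+delVec-∷ : ∀ {n} j Δ (σ : Stream n) i →
  insVec ((j , Δ) ∷ σ) i + delVec ((j , Δ) ∷ σ) i
    ≡ (if does (i ≟ j) then ∣ Δ ∣ else 0) + (insVec σ i + delVec σ i)
insVec+delVec-∷ j (+ k)    σ i = ins-step (does (i ≟ j))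
  where
  ins-step : ∀ b → (if b then k + insVec σ i else insVec σ i) + delVec σ i
                   ≡ (if b then k else 0) + (insVec σ i + delVec σ i)
  ins-step true  = ℕP.+-assoc k (insVec σ i) (delVec σ i)
  ins-step false = refl
insVec+delVec-∷ j -[1+ k ] σ i = del-step (does (i ≟ j))
  where
  del-step : ∀ b → insVec σ i + (if b then suc k + delVec σ i else delVec σ i)
                   ≡ (if b then suc k else 0) + (insVec σ i + delVec σ i)
  del-step true  = +-CS.x∙yz≈y∙xz (insVec σ i) (suc k) (delVec σ i)
  del-step false = refl

L1ID-∷ : ∀ {n} j Δ (σ : Stream n) → L1ID ((j , Δ) ∷ σ) ≡ ∣ Δ ∣ + L1ID σ
L1ID-∷ {n} j Δ σ = begin
  L1ID ((j , Δ) ∷ σ)                   ≡⟨ sumℕ≡sum (I+D ((j , Δ) ∷ σ)) ⟩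
  ℕΣ.sum (I+D ((j , Δ) ∷ σ))           ≡⟨ ℕΣ.sum-cong-≗ (insVec+delVec-∷ j Δ σ) ⟩
  ℕΣ.sum (λ i → at-j i + I+D σ i)      ≡⟨ ℕΣ.∑-distrib-+ at-j (I+D σ) ⟩
  ℕΣ.sum at-j + ℕΣ.sum (I+D σ)         ≡⟨ cong₂ _+_ mass-at-j (sym (sumℕ≡sum (I+D σ))) ⟩
  ∣ Δ ∣ + L1ID σ                       ∎
  where
  open ≡-Reasoning
  I+D : Stream n → Fin n → ℕ
  I+D σ i = insVec σ i + delVec σ i
  at-j : Fin n → ℕ
  at-j i = if does (i ≟ j) then ∣ Δ ∣ else 0
  mass-at-j : ℕΣ.sum at-j ≡ ∣ Δ ∣
  mass-at-j = trans (ℕΣ.sum-cong-≗ (λ i → cong (if_then ∣ Δ ∣ else 0) (does-≟-sym i j)))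
                    (sum-indicator ℕP.+-0-monoid j (λ _ → ∣ Δ ∣))

L1ID≡updateMass : ∀ {n} (σ : Stream n) → L1ID σ ≡ updateMass σ
L1ID≡updateMass {n} []  = trans (sumℕ≡sum {n} (λ _ → 0)) (ℕΣ.sum-replicate-zero n)
L1ID≡updateMass ((j , Δ) ∷ σ) = trans (L1ID-∷ j Δ σ) (cong (∣ Δ ∣ ℕ.+_) (L1ID≡updateMass σ))

ℕ-sum-const : ∀ k a → ℕΣ.sum {k} (λ _ → a) ≡ a * k
ℕ-sum-const zero    a = sym (ℕP.*-zeroʳ a)
ℕ-sum-const (suc k) a = trans (cong (a ℕ.+_) (ℕ-sum-const k a)) (sym (ℕP.*-suc a k))

sum-affine : ∀ {k} a b (f : Fin k → ℕ) → ℕΣ.sum (λ i → a + b * f i) ≡ a * k + b * ℕΣ.sum f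
sum-affine {k} a b f = begin
  ℕΣ.sum (λ i → a + b * f i)                      ≡⟨ ℕΣ.∑-distrib-+ (λ _ → a) (λ i → b * f i) ⟩
  ℕΣ.sum {k} (λ _ → a) + ℕΣ.sum (λ i → b * f i)
                            ≡⟨ cong₂ _+_ (ℕ-sum-const k a) (sym (ℕΣ.*-distribˡ-sum b f)) ⟩
  a * k + b * ℕΣ.sum f                            ∎
  where open ≡-Reasoning

aliceΔ : Bool → ℤ
aliceΔ false = + 5
aliceΔ true  = -[1+ 4 ]

bobΔ : Bool → ℤ
bobΔ false = -[1+ 0 ]
bobΔ true  = + 1

alice bob : ∀ {n} → (Fin n → Bool) → Stream n
alice x = vectorStream (aliceΔ ∘ x)
bob   y = vectorStream (bobΔ ∘ y)

bit : Bool → ℕ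
bit b = if b then 1 else 0

distance : ∀ {n} → (Fin n → Bool) → (Fin n → Bool) → ℕ
distance x y = ℕΣ.sum (λ i → bit (x i xor y i))

distance-self : ∀ {n} (x : Fin n → Bool) → distance x x ≡ 0
distance-self {n} x = trans (ℕΣ.sum-cong-≗ (λ i → cong bit (BoolP.xor-same (x i)))) (ℕΣ.sum-replicate-zero n)

∣aliceΔ+bobΔ∣ : ∀ a b → ∣ aliceΔ a ℤ.+ bobΔ b ∣ ≡ 4 + 2 * bit (a xor b)
∣aliceΔ+bobΔ∣ false false = refl
∣aliceΔ+bobΔ∣ false true  = refl
∣aliceΔ+bobΔ∣ true  false = refl
∣aliceΔ+bobΔ∣ true  true  = refl

∣aliceΔ∣ : ∀ a → ∣ aliceΔ a ∣ ≡ 5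
∣aliceΔ∣ false = refl
∣aliceΔ∣ true  = refl

∣bobΔ∣ : ∀ b → ∣ bobΔ b ∣ ≡ 1
∣bobΔ∣ false = refl
∣bobΔ∣ true  = refl

L1-alice++bob : ∀ {n} (x y : Fin n → Bool) → L1 (alice x ++ bob y) ≡ 4 * n + 2 * distance x y
L1-alice++bob {n} x y = begin
  L1 (alice x ++ bob y)                         ≡⟨ sumℕ≡sum (λ i → ∣ freq (alice x ++ bob y) i ∣) ⟩
  ℕΣ.sum (λ i → ∣ freq (alice x ++ bob y) i ∣)  ≡⟨ ℕΣ.sum-cong-≗ coordinate ⟩
  ℕΣ.sum (λ i → 4 + 2 * bit (x i xor y i))      ≡⟨ sum-affine 4 2 (λ i → bit (x i xor y i)) ⟩
  4 * n + 2 * distance x y                      ∎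
  where
  open ≡-Reasoning
  coordinate : ∀ i → ∣ freq (alice x ++ bob y) i ∣ ≡ 4 + 2 * bit (x i xor y i)
  coordinate i = trans (cong ∣_∣ (trans (freq-++ (alice x) (bob y) i)
                         (cong₂ ℤ._+_ (freq-vectorStream (aliceΔ ∘ x) i) (freq-vectorStream (bobΔ ∘ y) i))))
                       (∣aliceΔ+bobΔ∣ (x i) (y i))

L1ID-alice++bob : ∀ {n} (x y : Fin n → Bool) → L1ID (alice x ++ bob y) ≡ 6 * n
L1ID-alice++bob {n} x y = begin
  L1ID (alice x ++ bob y)                    ≡⟨ L1ID≡updateMass (alice x ++ bob y) ⟩
  updateMass (alice x ++ bob y)              ≡⟨ updateMass-++ (alice x) (bob y) ⟩
  updateMass (alice x) + updateMass (bob y)  ≡⟨ cong₂ _+_ (updateMass-tabulate id (aliceΔ ∘ x) (∣aliceΔ∣ ∘ x))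
                                                          (updateMass-tabulate id (bobΔ ∘ y) (∣bobΔ∣ ∘ y)) ⟩
  n * 5 + n * 1                              ≡⟨ ℕP.*-distribˡ-+ n 5 1 ⟨
  n * 6                                      ≡⟨ ℕP.*-comm n 6 ⟩
  6 * n                                      ∎
  where open ≡-Reasoning

alice++bob-valid : ∀ {n} m M (x y : Fin n → Bool) → n + n ≤ m → 5 ≤ M →
                   ValidStream m M (alice x ++ bob y)
alice++bob-valid {n} m M x y 2n≤m 5≤M = subst (_≤ m) (sym length-alice++bob) 2n≤m ,
  AllP.++⁺ (AllP.tabulate⁺ (λ j → subst (_≤ M) (sym (∣aliceΔ∣ (x j))) 5≤M))
           (AllP.tabulate⁺ (λ j → subst (_≤ M) (sym (∣bobΔ∣ (y j))) (ℕP.≤-trans (ℕ.s≤s ℕ.z≤n) 5≤M)))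
  where
  length-alice++bob : List.length (alice x ++ bob y) ≡ n + n
  length-alice++bob = trans (ListP.length-++ (alice x))
    (cong₂ _+_ (ListP.length-tabulate (λ j → (j , aliceΔ (x j))))
               (ListP.length-tabulate (λ j → (j , bobΔ (y j)))))

alice++bob-alpha : ∀ {n} α → (+ 3 / 2) ℚ.≤ α → (x y : Fin n → Bool) → AlphaProperty α (alice x ++ bob y)
alice++bob-alpha {n} α 3/2≤α x y =
  subst₂ (λ a b → toℚ a ℚ.≤ α ℚ.* toℚ b) (sym (L1ID-alice++bob x y)) (sym (L1-alice++bob x y)) (begin
    toℚ (6 * n)                    ≡⟨ toℚ-homo-* 6 n ⟩
    toℚ 6 ℚ.* toℚ n                ≡⟨⟩
    + 3 / 2 ℚ.* toℚ 4 ℚ.* toℚ n    ≡⟨ ℚP.*-assoc (+ 3 / 2) (toℚ 4) (toℚ n) ⟩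
    + 3 / 2 ℚ.* (toℚ 4 ℚ.* toℚ n)  ≡⟨ cong (+ 3 / 2 ℚ.*_) (toℚ-homo-* 4 n) ⟨
    + 3 / 2 ℚ.* toℚ (4 * n)        ≤⟨ ℚP.*-monoˡ-≤-nonNeg (+ 3 / 2) (toℚ-mono-≤ (ℕP.m≤m+n (4 * n) (2 * d))) ⟩
    + 3 / 2 ℚ.* toℚ L              ≤⟨ ℚP.*-monoʳ-≤-nonNeg (toℚ L) {{toℚ-nonNeg L}} 3/2≤α ⟩
    α ℚ.* toℚ L                    ∎)
  where
  open ℚP.≤-Reasoning
  d L : ℕ
  d = distance x y
  L = 4 * n + 2 * d

-- The number of vectors in {0,1}ᵏ of weight at most r.
ball : ℕ → ℕ → ℕ
ball zero    r       = 1
ball (suc k) zero    = ball k zero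
ball (suc k) (suc r) = ball k (suc r) + ball k r

weight : ∀ {k} → Vec Bool k → ℕ
weight = countᵇ id

↑ˡ≢↑ʳ : ∀ {a b} (i : Fin a) (j : Fin b) → i ↑ˡ b ≢ a ↑ʳ j
↑ˡ≢↑ʳ {a} {b} i j eq
  with trans (sym (FinP.splitAt-↑ˡ a i b)) (trans (cong (splitAt a) eq) (FinP.splitAt-↑ʳ a b j))
... | ()

ballCode : ∀ {k} r (v : Vec Bool k) → weight v ≤ r → Fin (ball k r)
ballCode r       []          _ = zero
ballCode zero    (false ∷ v) p = ballCode zero v p
ballCode zero    (true ∷ v)  ()
ballCode {suc k} (suc r) (false ∷ v) p = ballCode (suc r) v p ↑ˡ ball k r
ballCode {suc k} (suc r) (true ∷ v)  p = ball k (suc r) ↑ʳ ballCode r v (ℕ.s≤s⁻¹ p)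

ballCode-injective : ∀ {k} r (v v′ : Vec Bool k) p p′ → ballCode r v p ≡ ballCode r v′ p′ → v ≡ v′
ballCode-injective r [] [] _ _ _ = refl
ballCode-injective zero (false ∷ v) (false ∷ v′) p p′ eq = cong (false ∷_) (ballCode-injective zero v v′ p p′ eq)
ballCode-injective zero (true ∷ v)  _            ()
ballCode-injective zero (false ∷ v) (true ∷ v′)  _ ()
ballCode-injective {suc k} (suc r) (false ∷ v) (false ∷ v′) p p′ eq =
  cong (false ∷_) (ballCode-injective (suc r) v v′ p p′ (FinP.↑ˡ-injective (ball k r) _ _ eq))
ballCode-injective {suc k} (suc r) (true ∷ v) (true ∷ v′) p p′ eq =
  cong (true ∷_) (ballCode-injective r v v′ (ℕ.s≤s⁻¹ p) (ℕ.s≤s⁻¹ p′)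
                   (FinP.↑ʳ-injective (ball k (suc r)) _ _ eq))
ballCode-injective (suc r) (false ∷ v) (true ∷ v′) p p′ eq = ⊥-elim (↑ˡ≢↑ʳ _ _ eq)
ballCode-injective (suc r) (true ∷ v) (false ∷ v′) p p′ eq = ⊥-elim (↑ˡ≢↑ʳ _ _ (sym eq))

-- ball k r ≤ (1 + t)ᵏ / tʳ at t = 1/2, along the Pascal recursion.
ball-bound : ∀ k r → 2 ^ k * ball k r ≤ 2 ^ r * 3 ^ k
ball-bound zero    r       = ℕP.*-monoˡ-≤ 1 (ℕP.m^n>0 2 r)
ball-bound (suc k) zero    = begin
  2 * 2 ^ k * ball k 0     ≡⟨ ℕP.*-assoc 2 (2 ^ k) (ball k 0) ⟩
  2 * (2 ^ k * ball k 0)   ≤⟨ ℕP.*-monoʳ-≤ 2 (ball-bound k 0) ⟩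
  2 * (1 * 3 ^ k)          ≤⟨ ℕP.*-monoˡ-≤ (1 * 3 ^ k) (ℕP.n≤1+n 2) ⟩
  3 * (1 * 3 ^ k)          ≡⟨ cong (3 *_) (ℕP.*-identityˡ (3 ^ k)) ⟩
  3 ^ suc k                ≡⟨ sym (ℕP.*-identityˡ (3 ^ suc k)) ⟩
  1 * 3 ^ suc k            ∎
  where open ℕP.≤-Reasoning
ball-bound (suc k) (suc r) = begin
  2 * 2 ^ k * (ball k (suc r) + ball k r)
    ≡⟨ split (2 ^ k) (ball k (suc r)) (ball k r) ⟩
  2 * (2 ^ k * ball k (suc r)) + 2 * (2 ^ k * ball k r)
    ≤⟨ ℕP.+-mono-≤ (ℕP.*-monoʳ-≤ 2 (ball-bound k (suc r))) (ℕP.*-monoʳ-≤ 2 (ball-bound k r)) ⟩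
  2 * (2 * 2 ^ r * 3 ^ k) + 2 * (2 ^ r * 3 ^ k)
    ≡⟨ merge (2 ^ r) (3 ^ k) ⟩
  2 * 2 ^ r * (3 * 3 ^ k) ∎
  where
  open ℕP.≤-Reasoning
  split : ∀ t a b → 2 * t * (a + b) ≡ 2 * (t * a) + 2 * (t * b)
  split = solve-∀
  merge : ∀ t u → 2 * (2 * t * u) + 2 * (t * u) ≡ 2 * t * (3 * u)
  merge = solve-∀

xor-cancelˡ : ∀ a {b c} → a xor b ≡ a xor c → b ≡ c
xor-cancelˡ false eq = eq
xor-cancelˡ true  eq = BoolP.not-injective eq

weight-tabulate : ∀ {k} (d : Fin k → Bool) → weight (Vec.tabulate d) ≡ ℕΣ.sum (bit ∘ d)
weight-tabulate {zero}  d = refl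
weight-tabulate {suc k} d = trans (count-step (d zero)) (cong (bit (d zero) ℕ.+_) (weight-tabulate (d ∘ suc)))
  where
  count-step : ∀ b → (if b then suc else (λ w → w)) (weight (Vec.tabulate (d ∘ suc)))
                     ≡ bit b + weight (Vec.tabulate (d ∘ suc))
  count-step true  = refl
  count-step false = refl

module _ {a k} (φ : Fin a → Fin k) where

  Fibre : Fin k → Set
  Fibre y = ∃ λ i → φ i ≡ y

  choose : ∀ {y} → Fibre y → Fibre y
  choose {y} p with FinP.any? (λ i → φ i ≟ y)
  ... | yes q = q
  ... | no  _ = p

  choose-irrelevant : ∀ {y} (p p′ : Fibre y) → proj₁ (choose p) ≡ proj₁ (choose p′)
  choose-irrelevant {y} p p′ with FinP.any? (λ i → φ i ≟ y)
  ... | yes _ = refl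
  ... | no ¬q = ⊥-elim (¬q p)

  representative : Fin a → Fin a
  representative i = proj₁ (choose (i , refl))

  representative-fibre : ∀ i → φ (representative i) ≡ φ i
  representative-fibre i = proj₂ (choose (i , refl))

  representative-cong : ∀ {i j} → φ i ≡ φ j → representative i ≡ representative j
  representative-cong {i} {j} φi≡φj = choose-cong φi≡φj (i , refl) (j , refl)
    where
    choose-cong : ∀ {y y′} → y ≡ y′ → (p : Fibre y) (p′ : Fibre y′) → proj₁ (choose p) ≡ proj₁ (choose p′)
    choose-cong refl = choose-irrelevant

  fibrewise-injective⇒≤ : ∀ {b} (code : ∀ i j → φ i ≡ φ j → Fin b) →
    (∀ i j j′ e e′ → code i j e ≡ code i j′ e′ → j ≡ j′) → a ≤ k * b
  fibrewise-injective⇒≤ {b} code code-injective = FinP.injective⇒≤ {f = encode} encode-injective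
    where
    encode : Fin a → Fin (k * b)
    encode j = combine (φ j) (code (representative j) j (representative-fibre j))

    code-injective′ : ∀ {i i′ j j′} (e : φ i ≡ φ j) (e′ : φ i′ ≡ φ j′) →
                      i ≡ i′ → code i j e ≡ code i′ j′ e′ → j ≡ j′
    code-injective′ e e′ refl = code-injective _ _ _ e e′

    encode-injective : ∀ {j j′} → encode j ≡ encode j′ → j ≡ j′
    encode-injective {j} {j′} eq with FinP.combine-injective (φ j) _ (φ j′) _ eq
    ... | φj≡φj′ , codes≡ = code-injective′ (representative-fibre j) (representative-fibre j′)
                                            (representative-cong φj≡φj′) codes≡

funToFin-cong : ∀ {m n} {f g : Fin m → Fin n} → (∀ i → f i ≡ g i) → funToFin f ≡ funToFin g
funToFin-cong {zero}  _   = refl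
funToFin-cong {suc m} f≗g = cong₂ combine (f≗g zero) (funToFin-cong (f≗g ∘ suc))

bits : ∀ {n} → Fin (2 ^ n) → Fin n → Bool
bits {n} i t = Inverse.to FinP.2↔Bool (finToFun {2} {n} i t)

bits-injective : ∀ {n} {i j : Fin (2 ^ n)} → (∀ t → bits i t ≡ bits j t) → i ≡ j
bits-injective {n} {i} {j} bits≗ = begin
  i
    ≡⟨ FinP.funToFin-finToFin {n} {2} i ⟨
  funToFin (finToFun {2} {n} i)
    ≡⟨ funToFin-cong {n} {2} (λ t → Injection.injective (↔⇒↣ FinP.2↔Bool) (bits≗ t)) ⟩
  funToFin (finToFun {2} {n} j)
    ≡⟨ FinP.funToFin-finToFin {n} {2} j ⟩
  j ∎
  where open ≡-Reasoning

^-distribʳ-* : ∀ a b k → (a * b) ^ k ≡ a ^ k * b ^ k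
^-distribʳ-* a b zero    = refl
^-distribʳ-* a b (suc k) =
  trans (cong ((a * b) *_) (^-distribʳ-* a b k)) (ℕP.[m*n]*[o*p]≡[m*o]*[n*p] a b (a ^ k) (b ^ k))

^-swap : ∀ a m k → (a ^ m) ^ k ≡ (a ^ k) ^ m
^-swap a m k = trans (ℕP.^-*-assoc a m k) (trans (cong (a ^_) (ℕP.*-comm m k)) (sym (ℕP.^-*-assoc a k m)))

2^-cancel-≤ : ∀ {a b} → 2 ^ a ≤ 2 ^ b → a ≤ b
2^-cancel-≤ {a} {b} le = subst₂ _≤_ (⌊log₂[2^n]⌋≡n a) (⌊log₂[2^n]⌋≡n b) (⌊log₂⌋-mono-≤ le)

[2^[n/3]]³≤2^n : ∀ n → (2 ^ (n ℕ./ 3)) ^ 3 ≤ 2 ^ n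
[2^[n/3]]³≤2^n n =
  subst (_≤ 2 ^ n) (sym (ℕP.^-*-assoc 2 (n ℕ./ 3) 3)) (ℕP.^-monoʳ-≤ 2 (DivMod.m/n*n≤m n 3))

2ⁿ·[3ⁿ]¹⁵≤[2ⁿ]²⁵ : ∀ n → 2 ^ n * (3 ^ n) ^ 15 ≤ (2 ^ n) ^ 25
2ⁿ·[3ⁿ]¹⁵≤[2ⁿ]²⁵ n = begin
  2 ^ n * (3 ^ n) ^ 15   ≡⟨ cong (2 ^ n *_) (^-swap 3 n 15) ⟩
  2 ^ n * (3 ^ 15) ^ n   ≡⟨ ^-distribʳ-* 2 (3 ^ 15) n ⟨
  (2 * 3 ^ 15) ^ n       ≤⟨ ℕP.^-monoˡ-≤ n (ℕP.≤ᵇ⇒≤ (2 * 3 ^ 15) (2 ^ 25) _) ⟩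
  (2 ^ 25) ^ n           ≡⟨ ^-swap 2 25 n ⟩
  (2 ^ n) ^ 25           ∎
  where open ℕP.≤-Reasoning

-- With ball n (n/3) ≤ 2^(n/3)·(3/2)ⁿ the hypothesis gives 4ⁿ ≤ G·2^(n/3)·3ⁿ; cubing clears the
-- fractional exponent, and a fifth power brings in 2·3¹⁵ ≤ 2²⁵.
2^n≤G^15 : ∀ n G → 2 ^ n ≤ G * ball n (n ℕ./ 3) → 2 ^ n ≤ G ^ 15
2^n≤G^15 n G 2^n≤G·ball = ℕP.*-cancelʳ-≤ X (G ^ 15) (Y ^ 15) (begin
  X * Y ^ 15            ≤⟨ 2ⁿ·[3ⁿ]¹⁵≤[2ⁿ]²⁵ n ⟩
  X ^ 25                ≡⟨ ℕP.^-*-assoc X 5 5 ⟨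
  (X ^ 5) ^ 5           ≤⟨ ℕP.^-monoˡ-≤ 5 X⁵≤G³·Y³ ⟩
  (G ^ 3 * Y ^ 3) ^ 5   ≡⟨ solve 2 (λ g y → (g :^ 3 :* y :^ 3) :^ 5 := g :^ 15 :* y :^ 15) refl G Y ⟩
  G ^ 15 * Y ^ 15       ∎)
  where
  open ℕP.≤-Reasoning
  open ℕSolver.+-*-Solver using (solve; _:*_; _:^_; _:=_)
  X Y Z : ℕ
  X = 2 ^ n
  Y = 3 ^ n
  Z = 2 ^ (n ℕ./ 3)
  instance
    X≢0 : ℕ.NonZero X
    X≢0 = ℕP.m^n≢0 2 n
    Y¹⁵≢0 : ℕ.NonZero (Y ^ 15)
    Y¹⁵≢0 = ℕP.m^n≢0 Y 15 {{ℕP.m^n≢0 3 n}}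

  X²≤G·Z·Y : X * X ≤ G * (Z * Y)
  X²≤G·Z·Y = begin
    X * X                         ≤⟨ ℕP.*-monoʳ-≤ X 2^n≤G·ball ⟩
    X * (G * ball n (n ℕ./ 3))    ≡⟨ *-CS.x∙yz≈y∙xz X G (ball n (n ℕ./ 3)) ⟩
    G * (X * ball n (n ℕ./ 3))    ≤⟨ ℕP.*-monoʳ-≤ G (ball-bound n (n ℕ./ 3)) ⟩
    G * (Z * Y)                   ∎

  X⁵≤G³·Y³ : X ^ 5 ≤ G ^ 3 * Y ^ 3
  X⁵≤G³·Y³ = ℕP.*-cancelˡ-≤ X (begin
    X * X ^ 5              ≡⟨ solve 1 (λ x → x :* x :^ 5 := (x :* x) :^ 3) refl X ⟩
    (X * X) ^ 3            ≤⟨ ℕP.^-monoˡ-≤ 3 X²≤G·Z·Y ⟩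
    (G * (Z * Y)) ^ 3
      ≡⟨ solve 3 (λ g z y → (g :* (z :* y)) :^ 3 := g :^ 3 :* y :^ 3 :* z :^ 3) refl G Z Y ⟩
    G ^ 3 * Y ^ 3 * Z ^ 3  ≤⟨ ℕP.*-monoʳ-≤ (G ^ 3 * Y ^ 3) ([2^[n/3]]³≤2^n n) ⟩
    G ^ 3 * Y ^ 3 * X      ≡⟨ ℕP.*-comm (G ^ 3 * Y ^ 3) X ⟩
    X * (G ^ 3 * Y ^ 3)    ∎)

levels≤2^[3+s] : ∀ s → suc (suc (3 * 2 ^ s)) ≤ 2 ^ (3 + s)
levels≤2^[3+s] s = begin
  2 + 3 * a        ≤⟨ ℕP.+-monoˡ-≤ (3 * a) (ℕP.*-mono-≤ (ℕP.≤ᵇ⇒≤ 2 5 _) (ℕP.m^n>0 2 s)) ⟩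
  5 * a + 3 * a    ≡⟨ eight-times a ⟩
  2 ^ (3 + s)      ∎
  where
  open ℕP.≤-Reasoning
  a : ℕ
  a = 2 ^ s
  eight-times : ∀ a → 5 * a + 3 * a ≡ 2 * (2 * (2 * a))
  eight-times = solve-∀

messages≤ : ∀ s → suc (suc (3 * 2 ^ s)) ^ 2 ^ s ≤ 2 ^ ((3 + s) * 2 ^ s)
messages≤ s = subst (suc (suc (3 * 2 ^ s)) ^ 2 ^ s ≤_) (ℕP.^-*-assoc 2 (3 + s) (2 ^ s))
                    (ℕP.^-monoˡ-≤ (2 ^ s) (levels≤2^[3+s] s))

[3+s]2^s·15≤2^8s : ∀ s → (3 + suc s) * 2 ^ suc s * 15 ≤ 2 ^ (8 * suc s)
[3+s]2^s·15≤2^8s zero    = ℕP.≤ᵇ⇒≤ 120 256 _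
[3+s]2^s·15≤2^8s (suc s) = begin
  (3 + suc t) * (2 * a) * 15                         ≤⟨ ℕP.m≤m+n _ ((4 + 2 * t) * a * 15) ⟩
  (3 + suc t) * (2 * a) * 15 + (4 + 2 * t) * a * 15  ≡⟨ quadruple t a ⟩
  4 * ((3 + t) * a * 15)                             ≤⟨ ℕP.*-monoʳ-≤ 4 ([3+s]2^s·15≤2^8s s) ⟩
  4 * 2 ^ (8 * t)                                    ≤⟨ ℕP.*-monoˡ-≤ (2 ^ (8 * t)) (ℕP.≤ᵇ⇒≤ 4 256 _) ⟩
  2 ^ 8 * 2 ^ (8 * t)                                ≡⟨ ℕP.^-distribˡ-+-* 2 8 (8 * t) ⟨
  2 ^ (8 + 8 * t)                                    ≡⟨ cong (2 ^_) (ℕP.*-suc 8 t) ⟨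
  2 ^ (8 * suc t)                                    ∎
  where
  open ℕP.≤-Reasoning
  t a : ℕ
  t = suc s
  a = 2 ^ t
  quadruple : ∀ t a → (4 + t) * (2 * a) * 15 + (4 + 2 * t) * a * 15 ≡ 4 * ((3 + t) * a * 15)
  quadruple = solve-∀

⌊log₂⌋≤8s : ∀ n s → 46 ≤ n → n ≤ (3 + s) * 2 ^ s * 15 → ⌊log₂ n ⌋ ≤ 8 * s
⌊log₂⌋≤8s n zero    46≤n n≤45 = ⊥-elim (ℕP.<-irrefl refl (ℕP.≤-trans 46≤n n≤45))
⌊log₂⌋≤8s n (suc s) _    n≤T  = subst (⌊log₂ n ⌋ ≤_) (⌊log₂[2^n]⌋≡n (8 * suc s))
                                  (⌊log₂⌋-mono-≤ (ℕP.≤-trans n≤T ([3+s]2^s·15≤2^8s s)))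

15d≤4n⇒d≤n/3 : ∀ {d n} → 15 * d ≤ 4 * n → d ≤ n ℕ./ 3
15d≤4n⇒d≤n/3 {d} {n} 15d≤4n = subst (_≤ n ℕ./ 3) (DivMod.m*n/n≡m d 3) (DivMod./-monoˡ-≤ 3 d·3≤n)
  where
  d·3≤n : d * 3 ≤ n
  d·3≤n = ℕP.*-cancelˡ-≤ 5 (subst (_≤ 5 * n) (fifteen d)
                                 (ℕP.≤-trans 15d≤4n (ℕP.*-monoˡ-≤ n (ℕP.≤ᵇ⇒≤ 4 5 _))))
    where
    fifteen : ∀ d → 15 * d ≡ 5 * (d * 3)
    fifteen = solve-∀

far-norms : ∀ {n d} → 4 * n < 15 * d → 17 * (4 * n + 2 * 0) < 15 * (4 * n + 2 * d)
far-norms {n} {d} 4n<15d =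
  subst₂ _<_ (left n) (right n d) (ℕP.+-monoʳ-< (60 * n) (ℕP.*-monoʳ-< 2 4n<15d))
  where
  left : ∀ n → 60 * n + 2 * (4 * n) ≡ 17 * (4 * n + 2 * 0)
  left = solve-∀
  right : ∀ n d → 60 * n + 2 * (15 * d) ≡ 15 * (4 * n + 2 * d)
  right = solve-∀

module LowerBound {n s} (A : StreamAlg n s) {α m M} (3/2≤α : (+ 3 / 2) ℚ.≤ α)
                  (2n≤m : n + n ≤ m) (5≤M : 5 ≤ M) (solves : SolvesL1 α m M A) where
  open Run A
  open Fingerprint A (3 * 2 ^ s)

  message : (Fin n → Bool) → Fin (suc (suc (3 * 2 ^ s)) ^ 2 ^ s)
  message x = funToFin (stateLevel (alice x))

  succeeds : ∀ x y → (+ 2 / 3) ℚ.≤ successProb A (alice x ++ bob y)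
  succeeds x y =
    solves (alice x ++ bob y) (alice++bob-valid m M x y 2n≤m 5≤M) (alice++bob-alpha α 3/2≤α x y)

  3·2^s·resolution<1 : toℚ (3 * 2 ^ s) ℚ.* resolution ℚ.< 1ℚ
  3·2^s·resolution<1 = ℚP.<-≤-trans
    (ℚP.*-monoˡ-<-pos resolution {{ℚP.normalize-pos 1 (suc (3 * 2 ^ s))}}
                      (toℚ-mono-< (ℕP.n<1+n (3 * 2 ^ s))))
    (ℚP.≤-reflexive (toℚ-suc-*-inverse (3 * 2 ^ s)))

  same-message⇒close : ∀ x y → message x ≡ message y → 15 * distance x y ≤ 4 * n
  same-message⇒close x y same = ℕP.≮⇒≥ λ 4n<15d →
    nearby-states⇒¬both-succeed (alice y) (alice x) (bob y)
      resolution {{ℚP.normalize-nonNeg 1 (suc (3 * 2 ^ s))}} 3·2^s·resolution<1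
      (stateLevel-close (alice x) (alice y) same-levels)
      (subst₂ (λ a b → 17 * a < 15 * b) (sym L1-alice++bob-self) (sym (L1-alice++bob x y))
              (far-norms {n} {distance x y} 4n<15d))
      (succeeds y y) (succeeds x y)
    where
    same-levels : ∀ q → stateLevel (alice x) q ≡ stateLevel (alice y) q
    same-levels q = begin
      stateLevel (alice x) q                        ≡⟨ FinP.finToFun-funToFin (stateLevel (alice x)) q ⟨
      finToFun (message x) q                        ≡⟨ cong (λ c → finToFun c q) same ⟩
      finToFun (message y) q                        ≡⟨ FinP.finToFun-funToFin (stateLevel (alice y)) q ⟩
      stateLevel (alice y) q                        ∎
      where open ≡-Reasoning
    L1-alice++bob-self : L1 (alice y ++ bob y) ≡ 4 * n + 2 * 0
    L1-alice++bob-self = trans (L1-alice++bob y y) (cong (λ d → 4 * n + 2 * d) (distance-self y))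

  messages-bound : 2 ^ n ≤ suc (suc (3 * 2 ^ s)) ^ 2 ^ s * ball n (n ℕ./ 3)
  messages-bound = fibrewise-injective⇒≤ (message ∘ input) code code-injective
    where
    input : Fin (2 ^ n) → Fin n → Bool
    input = bits

    difference : Fin (2 ^ n) → Fin (2 ^ n) → Vec Bool n
    difference i j = Vec.tabulate (λ t → input i t xor input j t)

    code : ∀ i j → message (input i) ≡ message (input j) → Fin (ball n (n ℕ./ 3))
    code i j same = ballCode (n ℕ./ 3) (difference i j)
      (subst (_≤ n ℕ./ 3) (sym (weight-tabulate (λ t → input i t xor input j t)))
             (15d≤4n⇒d≤n/3 {distance (input i) (input j)} {n}
                            (same-message⇒close (input i) (input j) same)))

    code-injective : ∀ i j j′ e e′ → code i j e ≡ code i j′ e′ → j ≡ j′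
    code-injective i j j′ e e′ eq = bits-injective {n} λ t → xor-cancelˡ (input i t) (begin
      input i t xor input j t         ≡⟨ VecP.lookup∘tabulate (λ t → input i t xor input j t) t ⟨
      Vec.lookup (difference i j) t   ≡⟨ cong (λ v → Vec.lookup v t) same-difference ⟩
      Vec.lookup (difference i j′) t  ≡⟨ VecP.lookup∘tabulate (λ t → input i t xor input j′ t) t ⟩
      input i t xor input j′ t        ∎)
      where
      open ≡-Reasoning
      same-difference : difference i j ≡ difference i j′
      same-difference = ballCode-injective (n ℕ./ 3) (difference i j) (difference i j′) _ _ eq

n+n≤n^2 : ∀ {n} → 2 ≤ n → n + n ≤ n ^ 2
n+n≤n^2 {n} 2≤n = begin
  n + n        ≡⟨ cong (n ℕ.+_) (ℕP.+-identityʳ n) ⟨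
  2 * n        ≡⟨ ℕP.*-comm 2 n ⟩
  n * 2        ≤⟨ ℕP.*-monoʳ-≤ n 2≤n ⟩
  n * n        ≡⟨ cong (n *_) (ℕP.*-identityʳ n) ⟨
  n ^ 2        ∎
  where open ℕP.≤-Reasoning

space-lower-bound : ∀ {α} → (+ 3 / 2) ℚ.≤ α → ∀ {n m M s} (A : StreamAlg n s) →
  46 ≤ n → n + n ≤ m → 5 ≤ M → SolvesL1 α m M A → ⌊log₂ n ⌋ ≤ 8 * s
space-lower-bound 3/2≤α {n} {s = s} A 46≤n 2n≤m 5≤M solves = ⌊log₂⌋≤8s n s 46≤n (2^-cancel-≤ (begin
  2 ^ n                ≤⟨ 2^n≤G^15 n G (LowerBound.messages-bound A 3/2≤α 2n≤m 5≤M solves) ⟩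
  G ^ 15               ≤⟨ ℕP.^-monoˡ-≤ 15 (messages≤ s) ⟩
  (2 ^ T) ^ 15         ≡⟨ ℕP.^-*-assoc 2 T 15 ⟩
  2 ^ (T * 15)         ∎))
  where
  open ℕP.≤-Reasoning
  G T : ℕ
  G = suc (suc (3 * 2 ^ s)) ^ 2 ^ s
  T = (3 + s) * 2 ^ s

theorem8p4 : (α : ℚ) → (+ 3 / 2) ℚ.≤ α →
    Σ ℕ λ C → Σ ℕ λ d → Σ ℕ λ N →
      (n : ℕ) → N ≤ n → (m M : ℕ) → n ^ d ≤ m → n ^ d ≤ M →
      (s : ℕ) (A : StreamAlg n s) → SolvesL1 α m M A →
      ⌊log₂ n ⌋ ≤ C * s
theorem8p4 α 3/2≤α = 8 , 2 , 46 , λ n 46≤n m M n²≤m n²≤M s A →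
  let 2n≤n² = n+n≤n^2 (ℕP.≤-trans (ℕP.≤ᵇ⇒≤ 2 46 _) 46≤n)
      5≤n²  = ℕP.≤-trans (ℕP.≤ᵇ⇒≤ 5 46 _) (ℕP.≤-trans 46≤n (ℕP.≤-trans (ℕP.m≤m+n n n) 2n≤n²))
  in space-lower-bound 3/2≤α A 46≤n (ℕP.≤-trans 2n≤n² n²≤m) (ℕP.≤-trans 5≤n² n²≤M)
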